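{- For all sufficiently large positive integers $n$, $$ \#\left\{ S \subseteq \{1,2,\dots,n\} : \sum_{s \in S} \frac{1}{s} \leq 1 \right\} \leq 2^{0.93 n}.$$
   Context: The sum over the empty set is $0$. -}

module Defs where

open import Data.Nat using (ℕ; zero; suc)
open import Data.Bool using (true; false)
open import Data.Fin using (Fin; toℕ)
open import Data.Fin.Subset using (Subset; inside; outside)
open import Data.Vec using ([]; _∷_)
open import Data.List using (List; []; _∷_; map; _++_; filter; length)
open import Data.Integer using (+_)
open import Data.Rational using (ℚ; 0ℚ; 1ℚ; _+_; _/_; _≤_)
open import Data.Rational.Properties using (_≤?_)

-- A subset S of {1,…,n} is encoded as S : Subset n (= Vec Bool n);
-- position i : Fin n (0-based) stands for the integer i+1.

allSubsets : (n : ℕ) → List (Subset n)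
allSubsets zero = [] ∷ []
allSubsets (suc n) = map (inside ∷_) (allSubsets n) ++ map (outside ∷_) (allSubsets n)

recipSumFrom : {n : ℕ} → ℕ → Subset n → ℚ
recipSumFrom k [] = 0ℚ
recipSumFrom k (true ∷ S) = ((+ 1) / suc k) + recipSumFrom (suc k) S
recipSumFrom k (false ∷ S) = recipSumFrom (suc k) S

recipSum : {n : ℕ} → Subset n → ℚ
recipSum S = recipSumFrom 0 S

countRecipLe1 : ℕ → ℕ
countRecipLe1 n = length (filter (λ S → recipSum S ≤? 1ℚ) (allSubsets n))

-- Give the integer s a weight w(s) with w(s)·s ≤ L.  Then ∑_{s∈S} 1/s ≤ 1 forces ∑_{s∈S} w(s) ≤ L, and
-- Rankin's trick with x = 72/73 bounds the number of such S by x^(-L) ∏_{s≤n} (1 + x^w(s)).  Cut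
-- {1,…,60t} into 60 blocks of length t, give the b-th block the weight ⌊540/(b+1)⌋ and take L = 540t:
-- the bound becomes β^t with β = blockP/blockQ = (73/72)^540 ∏_{b<60} (1 + (72/73)^⌊540/(b+1)⌋),
-- and a direct computation gives β^10 ≤ 2^554.  With t = ⌊n/60⌋ + 1 this is at most 2^(0.93 n) once
-- n ≥ 9000.
module Submission where

open import Defs
open import Data.Nat
open import Data.Nat.Properties
open import Data.Nat.DivMod
open import Data.Nat.Divisibility using (n∣m*n)
open import Data.Nat.Tactic.RingSolver using (solve-∀)
open import Data.Nat.Coprimality using (1-coprimeTo)
open import Data.Bool using (true; false)
open import Data.Unit using (tt)
open import Data.Product using (∃-syntax; _,_)
open import Data.Vec using ([]; _∷_)
open import Data.Fin.Subset using (Subset; inside; outside)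
open import Data.List using ([]; _∷_; map; _++_; filter; length)
open import Data.List.Properties using (filter-++; filter-none; length-++)
import Data.List.Relation.Unary.All as All
open import Data.List.Relation.Binary.Sublist.Propositional using (⊆-refl)
open import Data.List.Relation.Binary.Sublist.Propositional.Properties using (filter⁺; length-mono-≤)
open import Data.Integer as ℤ using (+_)
import Data.Integer.Properties as ℤ
import Data.Integer.Tactic.RingSolver as ℤ
import Data.Rational as ℚ
import Data.Rational.Properties as ℚ
open import Data.Rational.Unnormalised as ℚᵘ using (ℚᵘ; mkℚᵘ; *≤*)
import Data.Rational.Unnormalised.Properties as ℚᵘ
open import Function using (_∘_; _$_)
open import Relation.Nullary using (¬_; yes; no)
open import Relation.Unary using (Decidable)
open import Relation.Binary.PropositionalEquality

^-distrib-* : ∀ x y n → (x * y) ^ n ≡ x ^ n * y ^ n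
^-distrib-* x y zero    = refl
^-distrib-* x y (suc n) = begin
  x * y * (x * y) ^ n       ≡⟨ cong (x * y *_) (^-distrib-* x y n) ⟩
  x * y * (x ^ n * y ^ n)   ≡⟨ [m*n]*[o*p]≡[m*o]*[n*p] x y (x ^ n) (y ^ n) ⟩
  x * x ^ n * (y * y ^ n)   ∎
  where open ≡-Reasoning

m<[1+m/n]*n : ∀ m n .{{_ : NonZero n}} → m < suc (m / n) * n
m<[1+m/n]*n m n = begin-strict
  m                   ≡⟨ m≡m%n+[m/n]*n m n ⟩
  m % n + m / n * n   <⟨ +-monoˡ-< (m / n * n) (m%n<n m n) ⟩
  n + m / n * n       ∎
  where open ≤-Reasoning

∏ : ℕ → ℕ → (ℕ → ℕ) → ℕ
∏ k zero    f = 1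
∏ k (suc m) f = f k * ∏ (suc k) m f

∏-+ : ∀ k a b f → ∏ k (a + b) f ≡ ∏ k a f * ∏ (k + a) b f
∏-+ k zero    b f = begin
  ∏ k b f            ≡⟨ cong (λ i → ∏ i b f) (sym (+-identityʳ k)) ⟩
  ∏ (k + 0) b f      ≡⟨ sym (*-identityˡ _) ⟩
  1 * ∏ (k + 0) b f  ∎
  where open ≡-Reasoning
∏-+ k (suc a) b f = begin
  f k * ∏ (suc k) (a + b) f                        ≡⟨ cong (f k *_) (∏-+ (suc k) a b f) ⟩
  f k * (∏ (suc k) a f * ∏ (suc k + a) b f)        ≡⟨ sym (*-assoc (f k) _ _) ⟩
  f k * ∏ (suc k) a f * ∏ (suc k + a) b f          ≡⟨ cong (λ i → f k * ∏ (suc k) a f * ∏ i b f) (sym (+-suc k a)) ⟩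
  f k * ∏ (suc k) a f * ∏ (k + suc a) b f          ∎
  where open ≡-Reasoning

∏-mono-≤ : ∀ {f g} → (∀ j → f j ≤ g j) → ∀ k m → ∏ k m f ≤ ∏ k m g
∏-mono-≤ f≤g k zero    = ≤-refl
∏-mono-≤ f≤g k (suc m) = *-mono-≤ (f≤g k) (∏-mono-≤ f≤g (suc k) m)

∏-const : ∀ k m f c → (∀ j → j < m → f (k + j) ≡ c) → ∏ k m f ≡ c ^ m
∏-const k zero    f c f≡c = refl
∏-const k (suc m) f c f≡c = cong₂ _*_
  (trans (cong f (sym (+-identityʳ k))) (f≡c 0 z<s))
  (∏-const (suc k) m f c (λ j j<m → trans (cong f (sym (+-suc k j))) (f≡c (suc j) (s<s j<m))))

∏-blocks : ∀ t f g → (∀ b j → j < t → f (b * t + j) ≡ g b) →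
           ∀ b J → ∏ (b * t) (J * t) f ≡ ∏ b J g ^ t
∏-blocks t f g f≡g b zero    = sym (^-zeroˡ t)
∏-blocks t f g f≡g b (suc J) = begin
  ∏ (b * t) (t + J * t) f                        ≡⟨ ∏-+ (b * t) t (J * t) f ⟩
  ∏ (b * t) t f * ∏ (b * t + t) (J * t) f        ≡⟨ cong₂ _*_ (∏-const (b * t) t f (g b) (f≡g b))
                                                              (cong (λ i → ∏ i (J * t) f) (+-comm (b * t) t)) ⟩
  g b ^ t * ∏ (suc b * t) (J * t) f              ≡⟨ cong (g b ^ t *_) (∏-blocks t f g f≡g (suc b) J) ⟩
  g b ^ t * ∏ (suc b) J g ^ t                    ≡⟨ sym (^-distrib-* (g b) _ t) ⟩
  (g b * ∏ (suc b) J g) ^ t                      ∎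
  where open ≡-Reasoning

module _ {a b} {A : Set a} {B : Set b} where

  length-filter-map : ∀ {p} {P : B → Set p} (P? : Decidable P) (f : A → B) xs →
                      length (filter P? (map f xs)) ≡ length (filter (P? ∘ f) xs)
  length-filter-map P? f []       = refl
  length-filter-map P? f (x ∷ xs) with P? (f x)
  ... | yes _ = cong suc (length-filter-map P? f xs)
  ... | no  _ = length-filter-map P? f xs

length-filter-mono : ∀ {a p q} {A : Set a} {P : A → Set p} {Q : A → Set q}
                     (P? : Decidable P) (Q? : Decidable Q) → (∀ {x} → P x → Q x) →
                     ∀ xs → length (filter P? xs) ≤ length (filter Q? xs)
length-filter-mono P? Q? P⇒Q xs = length-mono-≤ (filter⁺ P? Q? (λ { refl → P⇒Q }) (⊆-refl {x = xs}))

weightSumFrom : {n : ℕ} → (ℕ → ℕ) → ℕ → Subset n → ℕ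
weightSumFrom w k []          = 0
weightSumFrom w k (true ∷ S)  = w k + weightSumFrom w (suc k) S
weightSumFrom w k (false ∷ S) = weightSumFrom w (suc k) S

recipSumᵘFrom : {n : ℕ} → ℕ → Subset n → ℚᵘ
recipSumᵘFrom k []          = ℚᵘ.0ℚᵘ
recipSumᵘFrom k (true ∷ S)  = mkℚᵘ (+ 1) k ℚᵘ.+ recipSumᵘFrom (suc k) S
recipSumᵘFrom k (false ∷ S) = recipSumᵘFrom (suc k) S

toℚᵘ-recipSumFrom : ∀ {n} k (S : Subset n) → ℚ.toℚᵘ (recipSumFrom k S) ℚᵘ.≃ recipSumᵘFrom k S
toℚᵘ-recipSumFrom k []          = ℚᵘ.≃-refl
toℚᵘ-recipSumFrom k (true ∷ S)  = ℚᵘ.≃-trans (ℚ.toℚᵘ-homo-+ (+ 1 ℚ./ suc k) (recipSumFrom (suc k) S))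
  (ℚᵘ.+-cong (ℚᵘ.≃-reflexive (cong ℚ.toℚᵘ (ℚ.normalize-coprime (1-coprimeTo (suc k)))))
             (toℚᵘ-recipSumFrom (suc k) S))
toℚᵘ-recipSumFrom k (false ∷ S) = toℚᵘ-recipSumFrom (suc k) S

-- a ≤[ L ]· r  says  a ≤ L · r,  cross-multiplied so that it is additive without any normalisation.
infix 4 _≤[_]·_
_≤[_]·_ : ℕ → ℕ → ℚᵘ → Set
a ≤[ L ]· mkℚᵘ n d = + a ℤ.* + suc d ℤ.≤ n ℤ.* + L

≤·-+ : ∀ {a b L} r s → a ≤[ L ]· r → b ≤[ L ]· s → a + b ≤[ L ]· (r ℚᵘ.+ s)
≤·-+ {a} {b} {L} (mkℚᵘ m d) (mkℚᵘ n e) a≤Lr b≤Ls = begin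
  + (a + b) ℤ.* + (x * y)                         ≡⟨ cong₂ ℤ._*_ (ℤ.pos-+ a b) (ℤ.pos-* x y) ⟩
  (+ a ℤ.+ + b) ℤ.* (+ x ℤ.* + y)                 ≡⟨ expand (+ a) (+ b) (+ x) (+ y) ⟩
  + a ℤ.* + x ℤ.* + y ℤ.+ + b ℤ.* + y ℤ.* + x     ≤⟨ ℤ.+-mono-≤ (ℤ.*-monoʳ-≤-nonNeg (+ y) a≤Lr)
                                                                (ℤ.*-monoʳ-≤-nonNeg (+ x) b≤Ls) ⟩
  m ℤ.* + L ℤ.* + y ℤ.+ n ℤ.* + L ℤ.* + x         ≡⟨ collect m n (+ L) (+ x) (+ y) ⟩
  (m ℤ.* + y ℤ.+ n ℤ.* + x) ℤ.* + L               ∎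
  where
  open ℤ.≤-Reasoning
  x = suc d
  y = suc e
  expand : ∀ a b x y → (a ℤ.+ b) ℤ.* (x ℤ.* y) ≡ a ℤ.* x ℤ.* y ℤ.+ b ℤ.* y ℤ.* x
  expand = ℤ.solve-∀
  collect : ∀ m n L x y → m ℤ.* L ℤ.* y ℤ.+ n ℤ.* L ℤ.* x ≡ (m ℤ.* y ℤ.+ n ℤ.* x) ℤ.* L
  collect = ℤ.solve-∀

≤·-unitFraction : ∀ {a L} k → a * suc k ≤ L → a ≤[ L ]· mkℚᵘ (+ 1) k
≤·-unitFraction {a} {L} k a[1+k]≤L =
  subst₂ ℤ._≤_ (ℤ.pos-* a (suc k)) (sym (ℤ.*-identityˡ (+ L))) (ℤ.+≤+ a[1+k]≤L)

≤·-≤1 : ∀ {a L} r → a ≤[ L ]· r → r ℚᵘ.≤ ℚᵘ.1ℚᵘ → a ≤ L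
≤·-≤1 {a} {L} (mkℚᵘ n d) a≤Lr (*≤* n≤1+d) =
  ℤ.drop‿+≤+ (ℤ.*-cancelʳ-≤-pos (+ a) (+ L) (+ suc d) (ℤ.≤-trans a≤Lr nL≤L[1+d]))
  where
  nL≤L[1+d] : n ℤ.* + L ℤ.≤ + L ℤ.* + suc d
  nL≤L[1+d] = subst (n ℤ.* + L ℤ.≤_) (ℤ.*-comm (+ suc d) (+ L)) (ℤ.*-monoʳ-≤-nonNeg (+ L)
                (subst₂ ℤ._≤_ (ℤ.*-identityʳ n) (ℤ.*-identityˡ (+ suc d)) n≤1+d))

module _ (w : ℕ → ℕ) {L : ℕ} (w-admissible : ∀ j → w j * suc j ≤ L) where

  weightSum≤·recipSum : ∀ {n} k (S : Subset n) → weightSumFrom w k S ≤[ L ]· recipSumᵘFrom k S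
  weightSum≤·recipSum k []          = ℤ.≤-refl
  weightSum≤·recipSum k (true ∷ S)  = ≤·-+ (mkℚᵘ (+ 1) k) (recipSumᵘFrom (suc k) S)
    (≤·-unitFraction {w k} k (w-admissible k)) (weightSum≤·recipSum (suc k) S)
  weightSum≤·recipSum k (false ∷ S) = weightSum≤·recipSum (suc k) S

  recipSum≤1⇒weightSum≤ : ∀ {n} (S : Subset n) → recipSum S ℚ.≤ ℚ.1ℚ → weightSumFrom w 0 S ≤ L
  recipSum≤1⇒weightSum≤ S ∑≤1 = ≤·-≤1 (recipSumᵘFrom 0 S) (weightSum≤·recipSum 0 S)
    (ℚᵘ.≤-respˡ-≃ (toℚᵘ-recipSumFrom 0 S) (ℚ.toℚᵘ-mono-≤ ∑≤1))

module Rankin (p q : ℕ) where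

  -- With x = p/q this is Rankin's bound  c ≤ x^(-L) · P/Q.
  record RankinBound (c L Q P : ℕ) : Set where
    constructor rankinBound
    field inequality : c * p ^ L * Q ≤ q ^ L * P

  rankinBound-monoˡ : ∀ {c c′ L Q P} → c ≤ c′ → RankinBound c′ L Q P → RankinBound c L Q P
  rankinBound-monoˡ {L = L} {Q} c≤c′ (rankinBound h) = rankinBound (≤-trans (*-monoˡ-≤ Q (*-monoˡ-≤ (p ^ L) c≤c′)) h)

  rankinBound-shift : ∀ {c L Q P} x → x ≤ L → RankinBound c (L ∸ x) Q P →
                      RankinBound c L (q ^ x * Q) (p ^ x * P)
  rankinBound-shift {c} {L} {Q} {P} x x≤L (rankinBound bound) = rankinBound $ begin
    c * p ^ L * (q ^ x * Q)              ≡⟨ cong (λ z → c * z * (q ^ x * Q)) (^-split p) ⟩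
    c * (p ^ x * p ^ r) * (q ^ x * Q)    ≡⟨ regroupˡ c (p ^ x) (p ^ r) (q ^ x) Q ⟩
    c * p ^ r * Q * (p ^ x * q ^ x)      ≤⟨ *-monoˡ-≤ (p ^ x * q ^ x) bound ⟩
    q ^ r * P * (p ^ x * q ^ x)          ≡⟨ regroupʳ (q ^ r) P (p ^ x) (q ^ x) ⟩
    q ^ x * q ^ r * (p ^ x * P)          ≡⟨ cong (_* (p ^ x * P)) (sym (^-split q)) ⟩
    q ^ L * (p ^ x * P)                  ∎
    where
    open ≤-Reasoning
    r = L ∸ x
    ^-split : ∀ b → b ^ L ≡ b ^ x * b ^ r
    ^-split b = trans (cong (b ^_) (sym (m+[n∸m]≡n x≤L))) (^-distribˡ-+-* b x r)
    regroupˡ : ∀ c a b d e → c * (a * b) * (d * e) ≡ c * b * e * (a * d)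
    regroupˡ = solve-∀
    regroupʳ : ∀ a b c d → a * b * (c * d) ≡ d * a * (c * b)
    regroupʳ = solve-∀

  rankinBound-+ : ∀ {c₁ c₂ L Q P} x y → RankinBound c₁ L (x * Q) (y * P) → RankinBound c₂ L Q P →
                  RankinBound (c₁ + c₂) L (x * Q) ((x + y) * P)
  rankinBound-+ {c₁} {c₂} {L} {Q} {P} x y (rankinBound bound₁) (rankinBound bound₂) = rankinBound $ begin
    (c₁ + c₂) * p ^ L * (x * Q)                        ≡⟨ split c₁ c₂ (p ^ L) x Q ⟩
    c₁ * p ^ L * (x * Q) + c₂ * p ^ L * Q * x          ≤⟨ +-mono-≤ bound₁ (*-monoˡ-≤ x bound₂) ⟩
    q ^ L * (y * P) + q ^ L * P * x                    ≡⟨ merge (q ^ L) x y P ⟩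
    q ^ L * ((x + y) * P)                              ∎
    where
    open ≤-Reasoning
    split : ∀ c₁ c₂ a x Q → (c₁ + c₂) * a * (x * Q) ≡ c₁ * a * (x * Q) + c₂ * a * Q * x
    split = solve-∀
    merge : ∀ b x y P → b * (y * P) + b * P * x ≡ b * ((x + y) * P)
    merge = solve-∀

  rankinBound-* : ∀ {c L Q P Q′ P′} → RankinBound c L Q P → Q′ ≤ P′ → RankinBound c L (Q * Q′) (P * P′)
  rankinBound-* {c} {L} {Q} {P} {Q′} {P′} (rankinBound bound) Q′≤P′ = rankinBound $ begin
    c * p ^ L * (Q * Q′)     ≡⟨ sym (*-assoc (c * p ^ L) Q Q′) ⟩
    c * p ^ L * Q * Q′       ≤⟨ *-mono-≤ bound Q′≤P′ ⟩
    q ^ L * P * P′           ≡⟨ *-assoc (q ^ L) P P′ ⟩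
    q ^ L * (P * P′)         ∎
    where open ≤-Reasoning

  module _ (w : ℕ → ℕ) where

    countWeight≤ : ℕ → ℕ → ℕ → ℕ
    countWeight≤ k m L = length (filter (λ S → weightSumFrom w k S ≤? L) (allSubsets m))

    countWeight≤-withHead : ℕ → ℕ → ℕ → ℕ
    countWeight≤-withHead k m L = length (filter (λ S → w k + weightSumFrom w (suc k) S ≤? L) (allSubsets m))

    countWeight≤-suc : ∀ k m L → countWeight≤ k (suc m) L ≡ countWeight≤-withHead k m L + countWeight≤ (suc k) m L
    countWeight≤-suc k m L = begin
      length (filter P? (map (inside ∷_) A ++ map (outside ∷_) A))
        ≡⟨ cong length (filter-++ P? (map (inside ∷_) A) (map (outside ∷_) A)) ⟩
      length (filter P? (map (inside ∷_) A) ++ filter P? (map (outside ∷_) A))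
        ≡⟨ length-++ (filter P? (map (inside ∷_) A)) ⟩
      length (filter P? (map (inside ∷_) A)) + length (filter P? (map (outside ∷_) A))
        ≡⟨ cong₂ _+_ (length-filter-map P? (inside ∷_) A) (length-filter-map P? (outside ∷_) A) ⟩
      countWeight≤-withHead k m L + countWeight≤ (suc k) m L
        ∎
      where
      open ≡-Reasoning
      A = allSubsets m
      P? = λ (S : Subset (suc m)) → weightSumFrom w k S ≤? L

    countWeight≤-withHead-≤ : ∀ k m L → countWeight≤-withHead k m L ≤ countWeight≤ (suc k) m (L ∸ w k)
    countWeight≤-withHead-≤ k m L = length-filter-mono _ _
      (λ {S} h → m+n≤o⇒m≤o∸n (weightSumFrom w (suc k) S) (subst (_≤ L) (+-comm (w k) _) h)) (allSubsets m)

    countWeight≤-withHead-heavy : ∀ k m L → ¬ w k ≤ L → countWeight≤-withHead k m L ≡ 0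
    countWeight≤-withHead-heavy k m L wk≰L = cong length (filter-none _ (All.universal
      (λ S h → wk≰L (m+n≤o⇒m≤o (w k) h)) (allSubsets m)))

    qWeights pqWeights : ℕ → ℕ → ℕ
    qWeights  k m = ∏ k m (λ j → q ^ w j)
    pqWeights k m = ∏ k m (λ j → q ^ w j + p ^ w j)

    countWeight≤-rankinBound : p ≤ q → ∀ m k L → RankinBound (countWeight≤ k m L) L (qWeights k m) (pqWeights k m)
    countWeight≤-rankinBound p≤q zero    k L =
      rankinBound $ *-monoˡ-≤ 1 (subst (_≤ q ^ L) (sym (*-identityˡ (p ^ L))) (^-monoˡ-≤ L p≤q))
    countWeight≤-rankinBound p≤q (suc m) k L rewrite countWeight≤-suc k m L =
      rankinBound-+ (q ^ w k) (p ^ w k) withHead (countWeight≤-rankinBound p≤q m (suc k) L)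
      where
      withHead : RankinBound (countWeight≤-withHead k m L) L (q ^ w k * qWeights (suc k) m) (p ^ w k * pqWeights (suc k) m)
      withHead with w k ≤? L
      ... | yes wk≤L = rankinBound-shift (w k) wk≤L
                         (rankinBound-monoˡ (countWeight≤-withHead-≤ k m L) (countWeight≤-rankinBound p≤q m (suc k) (L ∸ w k)))
      ... | no  wk≰L rewrite countWeight≤-withHead-heavy k m L wk≰L = rankinBound z≤n

    countWeight≤-rankinBound-≤ : p ≤ q → ∀ {n N} L → n ≤ N →
                                 RankinBound (countWeight≤ 0 n L) L (qWeights 0 N) (pqWeights 0 N)
    countWeight≤-rankinBound-≤ p≤q {n} {N} L n≤N =
      subst (λ m → RankinBound (countWeight≤ 0 n L) L (qWeights 0 m) (pqWeights 0 m)) (m+[n∸m]≡n n≤N)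
        (subst₂ (RankinBound (countWeight≤ 0 n L) L) (sym (∏-+ 0 n (N ∸ n) _)) (sym (∏-+ 0 n (N ∸ n) _))
          (rankinBound-* (countWeight≤-rankinBound p≤q n 0 L) (∏-mono-≤ (λ j → m≤m+n (q ^ w j) (p ^ w j)) n (N ∸ n))))

blockWeight : ℕ → ℕ
blockWeight b = 540 / suc b

blockQ blockP : ℕ
blockQ = 72 ^ 540 * ∏ 0 60 (λ b → 73 ^ blockWeight b)
blockP = 73 ^ 540 * ∏ 0 60 (λ b → 73 ^ blockWeight b + 72 ^ blockWeight b)

blockQ-positive : 0 < blockQ
blockQ-positive = ≤ᵇ⇒≤ 1 blockQ tt

blockP^10≤2^554*blockQ^10 : blockP ^ 10 ≤ 2 ^ 554 * blockQ ^ 10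
blockP^10≤2^554*blockQ^10 = ≤ᵇ⇒≤ _ _ tt

module Blocks (t : ℕ) .{{_ : NonZero t}} where

  open Rankin 72 73

  weight : ℕ → ℕ
  weight j = blockWeight (j / t)

  weight-block : ∀ b j → j < t → weight (b * t + j) ≡ blockWeight b
  weight-block b j j<t = cong blockWeight $ begin
    (b * t + j) / t      ≡⟨ +-distrib-/-∣ˡ j (n∣m*n b) ⟩
    b * t / t + j / t    ≡⟨ cong₂ _+_ (m*n/n≡m b t) (m<n⇒m/n≡0 j<t) ⟩
    b + 0                ≡⟨ +-identityʳ b ⟩
    b                    ∎
    where open ≡-Reasoning

  weight-admissible : ∀ j → weight j * suc j ≤ 540 * t
  weight-admissible j = begin
    blockWeight b * suc j          ≤⟨ *-monoʳ-≤ (blockWeight b) (m<[1+m/n]*n j t) ⟩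
    blockWeight b * (suc b * t)    ≡⟨ sym (*-assoc (blockWeight b) (suc b) t) ⟩
    blockWeight b * suc b * t      ≤⟨ *-monoˡ-≤ t (m/n*n≤m 540 (suc b)) ⟩
    540 * t                        ∎
    where
    open ≤-Reasoning
    b = j / t

  blockQ^t : blockQ ^ t ≡ 72 ^ (540 * t) * qWeights weight 0 (60 * t)
  blockQ^t = begin
    (72 ^ 540 * ∏ 0 60 g) ^ t       ≡⟨ ^-distrib-* (72 ^ 540) (∏ 0 60 g) t ⟩
    (72 ^ 540) ^ t * ∏ 0 60 g ^ t   ≡⟨ cong₂ _*_ (^-*-assoc 72 540 t)
                                                 (sym (∏-blocks t _ g (λ b j j<t → cong (73 ^_) (weight-block b j j<t)) 0 60)) ⟩
    72 ^ (540 * t) * qWeights weight 0 (60 * t) ∎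
    where
    open ≡-Reasoning
    g = λ b → 73 ^ blockWeight b

  blockP^t : blockP ^ t ≡ 73 ^ (540 * t) * pqWeights weight 0 (60 * t)
  blockP^t = begin
    (73 ^ 540 * ∏ 0 60 g) ^ t       ≡⟨ ^-distrib-* (73 ^ 540) (∏ 0 60 g) t ⟩
    (73 ^ 540) ^ t * ∏ 0 60 g ^ t   ≡⟨ cong₂ _*_ (^-*-assoc 73 540 t)
                                                 (sym (∏-blocks t _ g (λ b j j<t → cong (λ e → 73 ^ e + 72 ^ e) (weight-block b j j<t)) 0 60)) ⟩
    73 ^ (540 * t) * pqWeights weight 0 (60 * t) ∎
    where
    open ≡-Reasoning
    g = λ b → 73 ^ blockWeight b + 72 ^ blockWeight b

  countRecipLe1-bound : ∀ n → n ≤ 60 * t → countRecipLe1 n * blockQ ^ t ≤ blockP ^ t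
  countRecipLe1-bound n n≤60t = begin
    countRecipLe1 n * blockQ ^ t                       ≤⟨ *-monoˡ-≤ (blockQ ^ t) count≤ ⟩
    c * blockQ ^ t                                     ≡⟨ cong (c *_) blockQ^t ⟩
    c * (72 ^ L * qWeights weight 0 (60 * t))          ≡⟨ sym (*-assoc c (72 ^ L) _) ⟩
    c * 72 ^ L * qWeights weight 0 (60 * t)            ≤⟨ RankinBound.inequality (countWeight≤-rankinBound-≤ weight (≤ᵇ⇒≤ 72 73 tt) L n≤60t) ⟩
    73 ^ L * pqWeights weight 0 (60 * t)               ≡⟨ sym blockP^t ⟩
    blockP ^ t                                         ∎
    where
    open ≤-Reasoning
    L = 540 * t
    c = countWeight≤ weight 0 n L
    count≤ : countRecipLe1 n ≤ c
    count≤ = length-filter-mono _ _ (λ {S} → recipSum≤1⇒weightSum≤ weight weight-admissible S) (allSubsets n)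

root-bound : ∀ c A B C k t → 0 < A → B ^ k ≤ C * A ^ k → c * A ^ t ≤ B ^ t → c ^ k ≤ C ^ t
root-bound c A B C k t 0<A Bᵏ≤CAᵏ cAᵗ≤Bᵗ =
  *-cancelʳ-≤ (c ^ k) (C ^ t) (A ^ (t * k)) {{m^n≢0 A (t * k) {{>-nonZero 0<A}}}} $ begin
    c ^ k * A ^ (t * k)          ≡⟨ cong (c ^ k *_) (sym (^-*-assoc A t k)) ⟩
    c ^ k * (A ^ t) ^ k          ≡⟨ sym (^-distrib-* c (A ^ t) k) ⟩
    (c * A ^ t) ^ k              ≤⟨ ^-monoˡ-≤ k cAᵗ≤Bᵗ ⟩
    (B ^ t) ^ k                  ≡⟨ ^-*-assoc B t k ⟩
    B ^ (t * k)                  ≡⟨ cong (B ^_) (*-comm t k) ⟩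
    B ^ (k * t)                  ≡⟨ sym (^-*-assoc B k t) ⟩
    (B ^ k) ^ t                  ≤⟨ ^-monoˡ-≤ t Bᵏ≤CAᵏ ⟩
    (C * A ^ k) ^ t              ≡⟨ ^-distrib-* C (A ^ k) t ⟩
    C ^ t * (A ^ k) ^ t          ≡⟨ cong (C ^ t *_) (trans (^-*-assoc A k t) (cong (A ^_) (*-comm k t))) ⟩
    C ^ t * A ^ (t * k)          ∎
  where open ≤-Reasoning

exponent-bound : ∀ n → 9000 ≤ n → 554 * suc (n / 60) * 10 ≤ 93 * n
exponent-bound n 9000≤n = begin
  554 * suc q * 10      ≡⟨ expand q ⟩
  5540 + 5540 * q       ≤⟨ +-monoˡ-≤ (5540 * q) (≤-trans (≤ᵇ⇒≤ 5540 6000 tt) (*-monoʳ-≤ 40 (/-monoˡ-≤ 60 9000≤n))) ⟩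
  40 * q + 5540 * q     ≡⟨ collect q ⟩
  93 * (q * 60)         ≤⟨ *-monoʳ-≤ 93 (m/n*n≤m n 60) ⟩
  93 * n                ∎
  where
  open ≤-Reasoning
  q = n / 60
  expand : ∀ q → 554 * suc q * 10 ≡ 5540 + 5540 * q
  expand = solve-∀
  collect : ∀ q → 40 * q + 5540 * q ≡ 93 * (q * 60)
  collect = solve-∀

mainTheorem1 : ∃[ N ] ((n : ℕ) → N ≤ n → countRecipLe1 n ^ 100 ≤ 2 ^ (93 * n))
mainTheorem1 = 9000 , λ n 9000≤n → let t = suc (n / 60) in begin
  countRecipLe1 n ^ 100             ≡⟨ sym (^-*-assoc (countRecipLe1 n) 10 10) ⟩
  (countRecipLe1 n ^ 10) ^ 10       ≤⟨ ^-monoˡ-≤ 10 (root-bound (countRecipLe1 n) blockQ blockP (2 ^ 554) 10 t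
                                         blockQ-positive blockP^10≤2^554*blockQ^10
                                         (Blocks.countRecipLe1-bound t n (n≤60t n))) ⟩
  ((2 ^ 554) ^ t) ^ 10              ≡⟨ trans (^-*-assoc (2 ^ 554) t 10) (^-*-assoc 2 554 (t * 10)) ⟩
  2 ^ (554 * (t * 10))              ≡⟨ cong (2 ^_) (sym (*-assoc 554 t 10)) ⟩
  2 ^ (554 * t * 10)                ≤⟨ ^-monoʳ-≤ 2 (exponent-bound n 9000≤n) ⟩
  2 ^ (93 * n)                      ∎
  where
  open ≤-Reasoning
  n≤60t : ∀ n → n ≤ 60 * suc (n / 60)
  n≤60t n = ≤-trans (<⇒≤ (m<[1+m/n]*n n 60)) (≤-reflexive (*-comm (suc (n / 60)) 60))
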